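{- Let $A=\langle\mathcal{D},\Sigma,\vec{x}_A,Q_A,\iota_A,F_A,\Delta_A\rangle$ and $B=\langle\mathcal{D},\Sigma,\vec{x}_B,Q_B,\iota_B,F_B,\Delta_B\rangle$ be data automata with $\vec{x}_B\subseteq\vec{x}_A$. Then $\mathcal{L}(A)\!\downarrow_{\vec{x}_B}\subseteq\mathcal{L}(B)$ if and only if $\mathcal{L}(A\times\overline{B})=\emptyset$.
   Context: $\mathcal{D}$ is a data domain with a first-order theory $\mathrm{Th}(\mathcal{D})$ closed under conjunction and negation. A data automaton (DA) $\langle \mathcal{D},\Sigma,\vec{x},Q,\iota,F,\Delta\rangle$ has a finite alphabet $\Sigma$ containing a padding symbol $\diamond$, a finite variable set $\vec x$, finite states $Q$, initial state $\iota$, final states $F$, and rules $q\xrightarrow{\sigma,\phi(\vec{x},\vec{x}')}q'$ with $\phi\in\mathrm{Th}(\mathcal{D})$. A trace is $w=(\nu_0,\sigma_0),\dots,(\nu_{n-1},\sigma_{n-1}),(\nu_n,\diamond)$ with valuations $\nu_i\in\mathcal{D}^{\vec x}$; a run over $w$ is $(q_0,\nu_0)\xrightarrow{\sigma_0}\cdots\xrightarrow{\sigma_{n-1}}(q_n,\nu_n)$ where for each $i$ there is a rule $q_i\xrightarrow{\sigma_i,\phi}q_{i+1}$ with $(\nu_i,\nu_{i+1})\models\phi$; $\mathcal{L}(\cdot)$ is the set of traces with a run from the initial state ending in a final state. For $\vec y\subseteq\vec x_A$, $w\!\downarrow_{\vec y}$ restricts every valuation of $w$ to $\vec y$, and $\mathcal{L}(A)\!\downarrow_{\vec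 y}=\{w\!\downarrow_{\vec y}\mid w\in\mathcal{L}(A)\}$. The complement $\overline{B}=\langle\mathcal{D},\Sigma,\vec x_B,2^{Q_B},\{\iota_B\},\{P\subseteq Q_B\mid P\cap F_B=\emptyset\},\Delta^d\rangle$, where $\Delta^d$ consists of all rules $P\xrightarrow{\sigma,\theta}P'$ such that every $p'\in P'$ has some $p\in P$ with $p\xrightarrow{\sigma,\psi}p'\in\Delta_B$, and $\theta\equiv\bigwedge_{p'\in P'}\bigvee_{p\in P,\,p\xrightarrow{\sigma,\psi}p'\in\Delta_B}\psi\wedge\bigwedge_{p'\in Q_B\setminus P'}\bigwedge_{p\in P,\,p\xrightarrow{\sigma,\varphi}p'\in\Delta_B}\neg\varphi$. The product $A\times\overline B$ is the DA over variables $\vec x_A$ with states $Q_A\times 2^{Q_B}$, initial state $(\iota_A,\{\iota_B\})$, final states $F_A\times\{P\mid P\cap F_B=\emptyset\}$, and rules $(q,P)\xrightarrow{\sigma,\phi\wedge\theta}(q',P')$ for every $q\xrightarrow{\sigma,\phi}q'\in\Delta_A$ and $P\xrightarrow{\sigma,\theta}P'\in\Delta^d$. -}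

module Defs where

open import Data.Bool using (Bool; true; false; _∧_; _∨_; not; if_then_else_)
open import Data.Nat using (ℕ; zero; suc)
open import Data.Fin using (Fin; _≟_)
open import Data.Fin.Subset using (Subset; _∈_; _∉_; inside; outside)
open import Data.Fin.Subset.Properties using (_∈?_)
open import Data.Vec using (Vec; []; _∷_)
open import Data.List using (List; []; _∷_; map; concatMap; allFin)
open import Data.Bool.ListAction using (all; any)
open import Data.List.Membership.Propositional using () renaming (_∈_ to _∈ₗ_)
open import Data.Product using (_×_; _,_; proj₁; proj₂)
open import Relation.Binary.PropositionalEquality using (_≡_)
open import Relation.Nullary.Decidable using (⌊_⌋)

-- Variables of an automaton are
-- Fin n, a valuation is a function Fin n → D, and a formula φ(x⃗, x⃗')
-- is represented semantically by its (two-valued) satisfaction relation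
-- on pairs of valuations.

Val : Set → ℕ → Set
Val D n = Fin n → D

Formula : Set → ℕ → Set
Formula D n = Val D n → Val D n → Bool

record Rule (D : Set) (k n : ℕ) (Q : Set) : Set where
  constructor rule
  field
    src   : Q
    sym   : Fin k
    guard : Formula D n
    tgt   : Q

record DA (D : Set) (k n : ℕ) (Q : Set) : Set where
  field
    init  : Q
    final : Q → Bool
    Δ     : List (Rule D k n Q)

open Rule public
open DA public

-- A trace (ν₀,σ₀),…,(νₙ₋₁,σₙ₋₁),(νₙ,⋄) is represented as the initial
-- valuation ν₀ together with the list of pairs (σᵢ, νᵢ₊₁); the final
-- padding symbol ⋄ is implicit.
Trace : Set → ℕ → ℕ → Set
Trace D k n = Val D n × List (Fin k × Val D n)

data Accepts {D : Set} {k n : ℕ} {Q : Set} (A : DA D k n Q)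
     : Q → Val D n → List (Fin k × Val D n) → Set where
  done : ∀ {q ν} → final A q ≡ true → Accepts A q ν []
  step : ∀ {q ν σ ν' rest} (r : Rule D k n Q) → r ∈ₗ Δ A →
         src r ≡ q → sym r ≡ σ → guard r ν ν' ≡ true →
         Accepts A (tgt r) ν' rest →
         Accepts A q ν ((σ , ν') ∷ rest)

Lang : {D : Set} {k n : ℕ} {Q : Set} → DA D k n Q → Trace D k n → Set
Lang A (ν₀ , steps) = Accepts A (init A) ν₀ steps

-- Restriction of a trace to a subset of the variables, given as an
-- (injective) embedding e : Fin nB → Fin nA.

restrictVal : {D : Set} {nA nB : ℕ} → (Fin nB → Fin nA) → Val D nA → Val D nB
restrictVal e ν x = ν (e x)

restrict : {D : Set} {k nA nB : ℕ} → (Fin nB → Fin nA) →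
           Trace D k nA → Trace D k nB
restrict e (ν₀ , steps) =
  restrictVal e ν₀ , map (λ p → proj₁ p , restrictVal e (proj₂ p)) steps

allSubsets : (m : ℕ) → List (Subset m)
allSubsets zero    = [] ∷ []
allSubsets (suc m) =
  concatMap (λ P → (inside ∷ P) ∷ (outside ∷ P) ∷ []) (allSubsets m)

module _ {D : Set} {k n m : ℕ} (B : DA D k n (Fin m)) where

  matches : Subset m → Fin k → Fin m → Rule D k n (Fin m) → Bool
  matches P σ p' r = ⌊ src r ∈? P ⌋ ∧ ⌊ sym r ≟ σ ⌋ ∧ ⌊ tgt r ≟ p' ⌋

  -- side condition for P --σ,θ--> P' to belong to Δᵈ:
  -- every p' ∈ P' has some p ∈ P with p --σ,ψ--> p' ∈ Δ_B
  dualOK : Subset m → Fin k → Subset m → Bool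
  dualOK P σ P' =
    all (λ p' → if ⌊ p' ∈? P' ⌋ then any (matches P σ p') (Δ B) else true)
        (allFin m)

  θ : Subset m → Fin k → Subset m → Formula D n
  θ P σ P' ν ν' =
    all (λ p' → if ⌊ p' ∈? P' ⌋
                then any (λ r → matches P σ p' r ∧ guard r ν ν') (Δ B)
                else all (λ r → if matches P σ p' r
                                then not (guard r ν ν') else true) (Δ B))
        (allFin m)

  disjointFinal : Subset m → Bool
  disjointFinal P =
    all (λ p → if ⌊ p ∈? P ⌋ then not (final B p) else true) (allFin m)

  singleton : Fin m → Subset m
  singleton q = Data.Vec.tabulate (λ p → if ⌊ p ≟ q ⌋ then inside else outside)
    where import Data.Vec

product : {D : Set} {k nA nB : ℕ} {QA : Set} {m : ℕ} →
          (Fin nB → Fin nA) → DA D k nA QA → DA D k nB (Fin m) →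
          DA D k nA (QA × Subset m)
product {m = m} e A B = record
  { init  = init A , singleton B (init B)
  ; final = λ s → final A (proj₁ s) ∧ disjointFinal B (proj₂ s)
  ; Δ     = concatMap
      (λ r → concatMap
        (λ P → concatMap
          (λ P' → if dualOK B P (sym r) P'
                  then rule (src r , P) (sym r)
                         (λ ν ν' → guard r ν ν' ∧
                                   θ B P (sym r) P' (restrictVal e ν) (restrictVal e ν'))
                         (tgt r , P') ∷ []
                  else [])
          (allSubsets m))
        (allSubsets m))
      (Δ A)
  }

module Submission where

-- The heart of the proof is the invariant of the subset construction
-- (product⇔): the product accepts the rest of a trace from (q , P) iff
-- A accepts it from q and no state of P lets B accept its restriction.
-- Two facts about the Boolean encoding of B̄ make this work.  A guard
-- θ P σ P' holds on (μ , μ') exactly when P' is the set of states B can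
-- reach from P reading σ under (μ , μ') (θ⇔), so the one-step successor
-- set 'post' is always available as a dual rule; and a final state of
-- B̄ is a set without final states of B (disjointFinal⇔).
--
-- The direction "empty product ⇒ inclusion" also
-- needs that acceptance by B of a fixed trace is decidable (accepts?),
-- since it argues by contradiction.

open import Defs
open import Data.Nat using (ℕ)
open import Data.Fin using (Fin)
open import Data.Product using (_×_)
open import Function.Definitions using (Injective)
open import Function.Bundles using (_⇔_)
open import Relation.Binary.PropositionalEquality using (_≡_)
open import Relation.Nullary using (¬_)

open import Data.Bool as Bool using (Bool; true; false; _∧_; not; if_then_else_)
open import Data.Bool.Properties using (T-≡; ∧-conicalˡ; ∧-conicalʳ)
open import Data.Bool.ListAction using (all; any)
open import Data.Empty using (⊥-elim)
open import Data.Fin as Fin using (_≟_)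
open import Data.Fin.Subset using (Subset; _∈_)
open import Data.Fin.Subset.Properties using (_∈?_)
open import Data.List using (List; []; _∷_; map; concatMap; allFin)
open import Data.List.Membership.Propositional using (find; lose) renaming (_∈_ to _∈ₗ_)
open import Data.List.Membership.Propositional.Properties using (∈-concatMap⁺; ∈-concatMap⁻; ∈-allFin)
open import Data.List.Relation.Unary.All as All using ()
open import Data.List.Relation.Unary.All.Properties using (all⁺; all⁻)
open import Data.List.Relation.Unary.Any using (Any; any?; here; there)
open import Data.List.Relation.Unary.Any.Properties using (any⁺; any⁻)
open import Data.Product using (∃; _,_; proj₁; proj₂)
open import Data.Vec as Vec using (tabulate)
open import Data.Vec.Properties using (lookup∘tabulate; []=⇒lookup; lookup⇒[]=)
open import Function.Bundles using (Equivalence; mk⇔)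
open import Function.Construct.Composition using () renaming (equivalence to ⇔-trans)
open import Relation.Binary.Definitions using (DecidableEquality)
open import Relation.Binary.PropositionalEquality as ≡ using (refl; cong; cong₂; subst)
open import Relation.Nullary using (Dec; yes; no)
open import Relation.Nullary.Decidable using (⌊_⌋; map′; _×-dec_; decidable-stable)

open Equivalence using (to; from)

⌊⌋⇔ : ∀ {Q : Set} (d : Dec Q) → (if ⌊ d ⌋ then true else false) ≡ true ⇔ Q
⌊⌋⇔ (yes q) = mk⇔ (λ _ → q) (λ _ → refl)
⌊⌋⇔ (no ¬q) = mk⇔ (λ ()) (λ q → ⊥-elim (¬q q))

implies⇔ : ∀ {Q : Set} (d : Dec Q) {b : Bool} →
           (if ⌊ d ⌋ then b else true) ≡ true ⇔ (Q → b ≡ true)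
implies⇔ (yes q) = mk⇔ (λ h _ → h) (λ h → h q)
implies⇔ (no ¬q) = mk⇔ (λ _ q → ⊥-elim (¬q q)) (λ _ → refl)

decides⇔ : ∀ {Q : Set} (d : Dec Q) {s t : Bool} → t ≡ not s →
           (if ⌊ d ⌋ then s else t) ≡ true ⇔ (Q ⇔ s ≡ true)
decides⇔ (yes q) {true}  refl = mk⇔ (λ _ → mk⇔ (λ _ → refl) (λ _ → q)) (λ _ → refl)
decides⇔ (yes q) {false} refl = mk⇔ (λ ()) (λ h → to h q)
decides⇔ (no ¬q) {true}  refl = mk⇔ (λ ()) (λ h → ⊥-elim (¬q (from h refl)))
decides⇔ (no ¬q) {false} refl = mk⇔ (λ _ → mk⇔ (λ q → ⊥-elim (¬q q)) (λ ())) (λ _ → refl)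

not⇔ : ∀ {b : Bool} → not b ≡ true ⇔ (¬ b ≡ true)
not⇔ {true}  = mk⇔ (λ ()) (λ h → ⊥-elim (h refl))
not⇔ {false} = mk⇔ (λ _ ()) (λ _ → refl)

all-allFin⇔ : ∀ {m} (f : Fin m → Bool) → all f (allFin m) ≡ true ⇔ (∀ i → f i ≡ true)
all-allFin⇔ f = mk⇔
  (λ h i → to T-≡ (All.lookup (all⁺ f (allFin _) (from T-≡ h)) (∈-allFin i)))
  (λ h → to T-≡ (all⁻ f {xs = allFin _} (All.tabulate (λ {i} _ → from T-≡ (h i)))))

any⇔ : ∀ {A : Set} (f : A → Bool) (xs : List A) →
       any f xs ≡ true ⇔ (∃ λ x → x ∈ₗ xs × f x ≡ true)
any⇔ f xs = mk⇔
  (λ h → let x , x∈ , fx = find (any⁻ f xs (from T-≡ h)) in x , x∈ , to T-≡ fx)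
  (λ (x , x∈ , fx) → to T-≡ (any⁺ f (lose x∈ (from T-≡ fx))))

none≡not-any : ∀ {A : Set} (g h : A → Bool) (xs : List A) →
               all (λ x → if g x then not (h x) else true) xs
                 ≡ not (any (λ x → g x ∧ h x) xs)
none≡not-any g h []       = refl
none≡not-any g h (x ∷ xs) with g x | h x
... | true  | true  = refl
... | true  | false = none≡not-any g h xs
... | false | _     = none≡not-any g h xs

∈-concatMap⇔ : ∀ {A B : Set} (f : A → List B) {y : B} {xs : List A} →
               y ∈ₗ concatMap f xs ⇔ (∃ λ x → x ∈ₗ xs × y ∈ₗ f x)
∈-concatMap⇔ f = mk⇔ (λ y∈ → find (∈-concatMap⁻ f y∈))
                     (λ (x , x∈ , y∈) → ∈-concatMap⁺ f (lose x∈ y∈))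

∈-if⇔ : ∀ {A : Set} (b : Bool) {y z : A} →
        y ∈ₗ (if b then z ∷ [] else []) ⇔ (b ≡ true × y ≡ z)
∈-if⇔ true  = mk⇔ (λ { (here y≡z) → refl , y≡z }) (λ (_ , y≡z) → here y≡z)
∈-if⇔ false = mk⇔ (λ ()) (λ ())

∈-tabulate⇔ : ∀ {m} (b : Fin m → Bool) (p : Fin m) → p ∈ tabulate b ⇔ b p ≡ true
∈-tabulate⇔ b p = mk⇔
  (λ p∈ → ≡.trans (≡.sym (lookup∘tabulate b p)) ([]=⇒lookup p∈))
  (λ bp → lookup⇒[]= p _ (≡.trans (lookup∘tabulate b p) bp))

allSubsets-complete : ∀ {m} (P : Subset m) → P ∈ₗ allSubsets m
allSubsets-complete Vec.[] = here refl
allSubsets-complete (s Vec.∷ P) =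
  from (∈-concatMap⇔ _) (P , allSubsets-complete P , either-side s)
  where
    either-side : ∀ s → (s Vec.∷ P) ∈ₗ ((true Vec.∷ P) ∷ (false Vec.∷ P) ∷ [])
    either-side true  = here refl
    either-side false = there (here refl)

-- A run on a nonempty trace is a choice of a matching, enabled rule
-- followed by a run on the rest; over a finite rule list this choice
-- is decidable, provided equality of states is.
accepts? : ∀ {D : Set} {k n : ℕ} {Q : Set} → DecidableEquality Q →
           (A : DA D k n Q) → ∀ q ν rest → Dec (Accepts A q ν rest)
accepts? _ A q ν [] = map′ done (λ { (done f) → f }) (final A q Bool.≟ true)
accepts? {D} {k} {n} {Q} _≟Q_ A q ν ((σ , ν') ∷ rest) =
  map′ fromFirstStep toFirstStep (any? firstStep? (Δ A))
  where
    FirstStep : Rule D k n Q → Set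
    FirstStep r = src r ≡ q × sym r ≡ σ × guard r ν ν' ≡ true × Accepts A (tgt r) ν' rest

    fromFirstStep : Any FirstStep (Δ A) → Accepts A q ν ((σ , ν') ∷ rest)
    fromFirstStep ∃r = let r , r∈ , s , a , g , acc = find ∃r in step r r∈ s a g acc

    toFirstStep : Accepts A q ν ((σ , ν') ∷ rest) → Any FirstStep (Δ A)
    toFirstStep (step r r∈ s a g acc) = lose r∈ (s , a , g , acc)

    firstStep? : ∀ r → Dec (FirstStep r)
    firstStep? r = (src r ≟Q q) ×-dec (sym r ≟ σ) ×-dec (guard r ν ν' Bool.≟ true)
                     ×-dec accepts? _≟Q_ A (tgt r) ν' rest

module Complement {D : Set} {k n m : ℕ} (B : DA D k n (Fin m)) where

  Move : Subset m → Fin k → Val D n → Val D n → Fin m → Set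
  Move P σ μ μ' p' = ∃ λ r → r ∈ₗ Δ B × src r ∈ P × sym r ≡ σ × tgt r ≡ p'
                                        × guard r μ μ' ≡ true

  enabled : Subset m → Fin k → Val D n → Val D n → Fin m → Bool
  enabled P σ μ μ' p' = any (λ r → matches B P σ p' r ∧ guard r μ μ') (Δ B)

  post : Subset m → Fin k → Val D n → Val D n → Subset m
  post P σ μ μ' = tabulate (enabled P σ μ μ')

  Rejects : Subset m → Val D n → List (Fin k × Val D n) → Set
  Rejects P μ rest = ∀ p → p ∈ P → ¬ Accepts B p μ rest

  matches⇔ : ∀ P σ p' r → matches B P σ p' r ≡ true ⇔ (src r ∈ P × sym r ≡ σ × tgt r ≡ p')
  matches⇔ P σ p' r with src r ∈? P | sym r ≟ σ | tgt r ≟ p'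
  ... | yes s | yes a | yes t = mk⇔ (λ _ → s , a , t) (λ _ → refl)
  ... | no ¬s | _     | _     = mk⇔ (λ ()) (λ (s , _) → ⊥-elim (¬s s))
  ... | yes _ | no ¬a | _     = mk⇔ (λ ()) (λ (_ , a , _) → ⊥-elim (¬a a))
  ... | yes _ | yes _ | no ¬t = mk⇔ (λ ()) (λ (_ , _ , t) → ⊥-elim (¬t t))

  enabled⇔ : ∀ P σ μ μ' p' → enabled P σ μ μ' p' ≡ true ⇔ Move P σ μ μ' p'
  enabled⇔ P σ μ μ' p' = mk⇔
    (λ h → let r , r∈ , mg = to (any⇔ _ (Δ B)) h
               s , a , t   = to (matches⇔ P σ p' r) (∧-conicalˡ _ _ mg)
           in r , r∈ , s , a , t , ∧-conicalʳ _ _ mg)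
    (λ (r , r∈ , s , a , t , g) →
       from (any⇔ _ (Δ B)) (r , r∈ , cong₂ _∧_ (from (matches⇔ P σ p' r) (s , a , t)) g))

  ∈-post⇔ : ∀ {P σ μ μ' p'} → p' ∈ post P σ μ μ' ⇔ Move P σ μ μ' p'
  ∈-post⇔ {P} {σ} {μ} {μ'} {p'} = ⇔-trans (∈-tabulate⇔ _ p') (enabled⇔ P σ μ μ' p')

  θ⇔ : ∀ P σ P' μ μ' →
       θ B P σ P' μ μ' ≡ true ⇔ (∀ p' → p' ∈ P' ⇔ enabled P σ μ μ' p' ≡ true)
  θ⇔ P σ P' μ μ' = ⇔-trans (all-allFin⇔ _)
    (mk⇔ (λ h p' → to (entry p') (h p')) (λ h p' → from (entry p') (h p')))
    where
      entry : ∀ p' → (if ⌊ p' ∈? P' ⌋ then enabled P σ μ μ' p'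
                      else all (λ r → if matches B P σ p' r then not (guard r μ μ') else true)
                               (Δ B)) ≡ true
                     ⇔ (p' ∈ P' ⇔ enabled P σ μ μ' p' ≡ true)
      entry p' = decides⇔ (p' ∈? P')
                   (none≡not-any (matches B P σ p') (λ r → guard r μ μ') (Δ B))

  θ-post : ∀ P σ μ μ' → θ B P σ (post P σ μ μ') μ μ' ≡ true
  θ-post P σ μ μ' = from (θ⇔ P σ _ μ μ') (∈-tabulate⇔ _)

  θ-closed : ∀ {P σ P' μ μ' p'} → θ B P σ P' μ μ' ≡ true → Move P σ μ μ' p' → p' ∈ P'
  θ-closed {P} {σ} {P'} {μ} {μ'} {p'} θ-holds move =
    from (to (θ⇔ P σ P' μ μ') θ-holds p') (from (enabled⇔ P σ μ μ' p') move)

  θ⇒dualOK : ∀ {P σ P' μ μ'} → θ B P σ P' μ μ' ≡ true → dualOK B P σ P' ≡ true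
  θ⇒dualOK {P} {σ} {P'} {μ} {μ'} θ-holds =
    from (all-allFin⇔ _) λ p' → from (implies⇔ (p' ∈? P')) λ p'∈P' →
      let r , r∈ , mg = to (any⇔ _ (Δ B)) (to (to (θ⇔ P σ P' μ μ') θ-holds p') p'∈P')
      in from (any⇔ _ (Δ B)) (r , r∈ , ∧-conicalˡ _ _ mg)

  disjointFinal⇔ : ∀ P → disjointFinal B P ≡ true ⇔ (∀ p → p ∈ P → ¬ final B p ≡ true)
  disjointFinal⇔ P = ⇔-trans (all-allFin⇔ _)
    (mk⇔ (λ h p p∈P → to not⇔ (to (implies⇔ (p ∈? P)) (h p) p∈P))
         (λ h p → from (implies⇔ (p ∈? P)) (λ p∈P → from not⇔ (h p p∈P))))

  ∈-singleton⇔ : ∀ {p q} → p ∈ singleton B q ⇔ p ≡ q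
  ∈-singleton⇔ {p} {q} = ⇔-trans (∈-tabulate⇔ _ p) (⌊⌋⇔ (p ≟ q))

  rejects-post : ∀ {P σ μ μ' rest} → Rejects P μ ((σ , μ') ∷ rest) →
                 Rejects (post P σ μ μ') μ' rest
  rejects-post rej p' p'∈ accB =
    let r , r∈ , s , a , t , g = to ∈-post⇔ p'∈
    in rej (src r) s (step r r∈ refl a g (subst (λ x → Accepts B x _ _) (≡.sym t) accB))

module Product {D : Set} {k nA nB mA mB : ℕ}
  (A : DA D k nA (Fin mA)) (B : DA D k nB (Fin mB)) (e : Fin nB → Fin nA) where

  open Complement B

  PR : DA D k nA (Fin mA × Subset mB)
  PR = product e A B

  restrictSteps : List (Fin k × Val D nA) → List (Fin k × Val D nB)
  restrictSteps = map (λ p → proj₁ p , restrictVal e (proj₂ p))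

  productRule : Rule D k nA (Fin mA) → Subset mB → Subset mB →
                Rule D k nA (Fin mA × Subset mB)
  productRule r P P' = rule (src r , P) (sym r)
    (λ ν ν' → guard r ν ν' ∧ θ B P (sym r) P' (restrictVal e ν) (restrictVal e ν'))
    (tgt r , P')

  -- Δ PR is, by definition, concatMap rulesFrom (Δ A): each rule r of A
  -- is paired with every legal dual rule P → P'.
  dualRules : Rule D k nA (Fin mA) → Subset mB → Subset mB →
              List (Rule D k nA (Fin mA × Subset mB))
  dualRules r P P' = if dualOK B P (sym r) P' then productRule r P P' ∷ [] else []

  rulesFrom : Rule D k nA (Fin mA) → List (Rule D k nA (Fin mA × Subset mB))
  rulesFrom r = concatMap (λ P → concatMap (dualRules r P) (allSubsets mB)) (allSubsets mB)

  productΔ⁺ : ∀ {r P P'} → r ∈ₗ Δ A → dualOK B P (sym r) P' ≡ true →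
              productRule r P P' ∈ₗ Δ PR
  productΔ⁺ {r} {P} {P'} r∈ ok =
    from (∈-concatMap⇔ rulesFrom) (r , r∈ ,
      from (∈-concatMap⇔ _) (P , allSubsets-complete P ,
        from (∈-concatMap⇔ (dualRules r P)) (P' , allSubsets-complete P' ,
          from (∈-if⇔ _) (ok , refl))))

  productΔ⁻ : ∀ {r} → r ∈ₗ Δ PR →
              ∃ λ rA → ∃ λ P → ∃ λ P' → rA ∈ₗ Δ A × r ≡ productRule rA P P'
  productΔ⁻ r∈ =
    let rA , rA∈ , r∈₁ = to (∈-concatMap⇔ rulesFrom) r∈
        P  , _   , r∈₂ = to (∈-concatMap⇔ (λ P → concatMap (dualRules rA P) (allSubsets mB))
                                          {xs = allSubsets mB}) r∈₁
        P' , _   , r∈₃ = to (∈-concatMap⇔ (dualRules rA P) {xs = allSubsets mB}) r∈₂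
    in rA , P , P' , rA∈ , proj₂ (to (∈-if⇔ (dualOK B P (sym rA) P')) r∈₃)

  ProductStep : Fin mA × Subset mB → Fin k → Val D nA → Val D nA →
                Rule D k nA (Fin mA × Subset mB) → Set
  ProductStep s σ ν ν' r =
    ∃ λ rA → ∃ λ P' → rA ∈ₗ Δ A × src rA ≡ proj₁ s × sym rA ≡ σ × guard rA ν ν' ≡ true
                    × θ B (proj₂ s) σ P' (restrictVal e ν) (restrictVal e ν') ≡ true
                    × tgt r ≡ (tgt rA , P')

  productStep⁻ : ∀ {s σ ν ν' r} → r ∈ₗ Δ PR → src r ≡ s → sym r ≡ σ →
                 guard r ν ν' ≡ true → ProductStep s σ ν ν' r
  productStep⁻ r∈ = split (productΔ⁻ r∈)
    where
      split : ∀ {s σ ν ν' r} →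
              (∃ λ rA → ∃ λ P → ∃ λ P' → rA ∈ₗ Δ A × r ≡ productRule rA P P') →
              src r ≡ s → sym r ≡ σ → guard r ν ν' ≡ true → ProductStep s σ ν ν' r
      split (rA , _ , P' , rA∈ , refl) refl refl g =
        rA , P' , rA∈ , refl , refl , ∧-conicalˡ _ _ g , ∧-conicalʳ _ _ g , refl

  product⇒A : ∀ {s ν rest} → Accepts PR s ν rest → Accepts A (proj₁ s) ν rest
  product⇒A (done f) = done (∧-conicalˡ _ _ f)
  product⇒A (step r r∈ s a g acc) =
    let rA , _ , rA∈ , sA , aA , gA , _ , t = productStep⁻ r∈ s a g
    in step rA rA∈ sA aA gA (subst (λ q → Accepts A q _ _) (cong proj₁ t) (product⇒A acc))

  product⇒rejects : ∀ {s ν rest} → Accepts PR s ν rest →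
                    Rejects (proj₂ s) (restrictVal e ν) (restrictSteps rest)
  product⇒rejects (done f) p p∈P (done fin) =
    to (disjointFinal⇔ _) (∧-conicalʳ _ _ f) p p∈P fin
  product⇒rejects (step r r∈ s a g acc) p p∈P (step r' r'∈ s' a' g' accB) =
    let _ , P' , _ , _ , _ , _ , θ-holds , t = productStep⁻ r∈ s a g
        p'∈P' = θ-closed θ-holds (r' , r'∈ , subst (_∈ _) (≡.sym s') p∈P , a' , refl , g')
    in product⇒rejects acc (tgt r') (subst (tgt r' ∈_) (≡.sym (cong proj₂ t)) p'∈P') accB

  A×rejects⇒product : ∀ {q P ν rest} → Accepts A q ν rest →
                      Rejects P (restrictVal e ν) (restrictSteps rest) →
                      Accepts PR (q , P) ν rest
  A×rejects⇒product {P = P} (done f) rej =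
    done (cong₂ _∧_ f (from (disjointFinal⇔ P) (λ p p∈P fin → rej p p∈P (done fin))))
  A×rejects⇒product {P = P} {ν = ν} (step {ν' = ν'} r r∈ refl refl g acc) rej =
    step (productRule r P P') (productΔ⁺ r∈ (θ⇒dualOK θ-holds)) refl refl
         (cong₂ _∧_ g θ-holds) (A×rejects⇒product acc (rejects-post rej))
    where
      P' = post P (sym r) (restrictVal e ν) (restrictVal e ν')
      θ-holds = θ-post P (sym r) (restrictVal e ν) (restrictVal e ν')

  product⇔ : ∀ {q P ν rest} → Accepts PR (q , P) ν rest
             ⇔ (Accepts A q ν rest × Rejects P (restrictVal e ν) (restrictSteps rest))
  product⇔ = mk⇔ (λ acc → product⇒A acc , product⇒rejects acc)
                 (λ (accA , rej) → A×rejects⇒product accA rej)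

lemma2 : {D : Set} {k nA nB mA mB : ℕ}
         (A : DA D k nA (Fin mA)) (B : DA D k nB (Fin mB))
         (e : Fin nB → Fin nA) → Injective _≡_ _≡_ e →
         (∀ (w : Trace D k nA) → Lang A w → Lang B (restrict e w))
           ⇔ (∀ (w : Trace D k nA) → ¬ Lang (product e A B) w)
lemma2 A B e _ = mk⇔ inclusion⇒empty empty⇒inclusion
  where
    open Complement B using (∈-singleton⇔)
    open Product A B e using (product⇔)

    -- A product run would be an A-run whose restriction B rejects.
    inclusion⇒empty : (∀ w → Lang A w → Lang B (restrict e w)) →
                      ∀ w → ¬ Lang (product e A B) w
    inclusion⇒empty incl w acc =
      let accA , rej = to product⇔ acc
      in rej (init B) (from ∈-singleton⇔ refl) (incl w accA)

    -- If B rejected the restriction of an A-run, the product would accept.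
    empty⇒inclusion : (∀ w → ¬ Lang (product e A B) w) →
                      ∀ w → Lang A w → Lang B (restrict e w)
    empty⇒inclusion empty w accA =
      decidable-stable (accepts? Fin._≟_ B (init B) _ _) λ ¬accB →
        empty w (from product⇔ (accA , λ p p∈ι →
          subst (λ q → ¬ Accepts B q _ _) (≡.sym (to ∈-singleton⇔ p∈ι)) ¬accB))
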